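{- There exist infinitely many EPS-graphs, i.e. there are infinitely many graphs $H$ such that $H$ is an $l$-EPS-graph for some positive integer $l$.
   Context: All graphs are finite and simple. $\mathcal{C}$ is the family of complete graphs; $S_2$ the edgeless graph on two vertices; $K_2$ the single edge; $\iota(J)$ the family of graphs isomorphic to induced subgraphs of $J$; $\mathcal{F}_1\vee\mathcal{F}_2$ (resp. $\mathcal{F}_1\wedge\mathcal{F}_2$) the family of disjoint unions (resp. joins) of a graph in $\mathcal{F}_1$ and a graph in $\mathcal{F}_2$; $\mathcal{C}^+$ is the family of graphs $G$ that are complete or such that $G\setminus v$ is complete for some vertex $v$ of degree at most $1$. A star is $K_{1,m}$. For a positive integer $l$, a graph $H$ is an $l$-EPS-graph if: (EPS1) for every $1\le s\le l$, $V(H)$ can be partitioned into $s$ stable sets and $l-s$ cliques; (EPS2) for each $\mathcal{G}\in\{\iota(S_2)\vee\mathcal{C},\ \iota(K_2)\vee\mathcal{C},\ \iota(S_2)\wedge\mathcal{C},\ \mathcal{C}^+\}$, $V(H)$ can be partitioned into $l-1$ cliques and a set inducing a graph in $\mathcal{G}$; (EPS3) there is no partition $(X_1,\dots,X_l)$ of $V(H)$ such that $H[X_1]$ is a clique or the complement of a star and $X_i$ is a clique of $H$ for $2\le i\le l$. -}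

module Defs where

open import Data.Nat using (ℕ; _≤_; _<_)
open import Data.Fin using (Fin; toℕ)
open import Data.Bool using (Bool; true; false)
open import Data.Product using (Σ; ∃; ∃-syntax; _×_; _,_)
open import Data.Sum using (_⊎_)
open import Relation.Nullary using (¬_)
open import Relation.Binary.PropositionalEquality using (_≡_; _≢_)

record Graph : Set where
  field
    n      : ℕ
    adj    : Fin n → Fin n → Bool
    sym    : ∀ u v → adj u v ≡ adj v u
    irrefl : ∀ v → adj v v ≡ false

module _ (G : Graph) where
  open Graph G

  E : Fin n → Fin n → Set
  E u v = adj u v ≡ true

  VSet : Set₁
  VSet = Fin n → Set

  Clique : VSet → Set
  Clique X = ∀ u v → X u → X v → u ≢ v → E u v

  Stable : VSet → Set
  Stable X = ∀ u v → X u → X v → u ≢ v → ¬ E u v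

  AtMost1 : VSet → Set
  AtMost1 X = ∀ u v → X u → X v → u ≡ v

  AtMost2 : VSet → Set
  AtMost2 X = ∀ u v w → X u → X v → X w → u ≡ v ⊎ u ≡ w ⊎ v ≡ w

  SideA SideB : VSet → (Fin n → Bool) → VSet
  SideA X side v = X v × side v ≡ true
  SideB X side v = X v × side v ≡ false

  -- G[X] ∈ ι(S₂) ∨ 𝒞 : disjoint union (no edges between) of a graph
  -- isomorphic to an induced subgraph of S₂ and a complete graph
  InUnionS2C : VSet → Set
  InUnionS2C X = ∃[ side ]
    ( AtMost2 (SideA X side) × Stable (SideA X side) × Clique (SideB X side)
    × (∀ u v → SideA X side u → SideB X side v → ¬ E u v))

  InUnionK2C : VSet → Set
  InUnionK2C X = ∃[ side ]
    ( AtMost2 (SideA X side) × Clique (SideA X side) × Clique (SideB X side)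
    × (∀ u v → SideA X side u → SideB X side v → ¬ E u v))

  InJoinS2C : VSet → Set
  InJoinS2C X = ∃[ side ]
    ( AtMost2 (SideA X side) × Stable (SideA X side) × Clique (SideB X side)
    × (∀ u v → SideA X side u → SideB X side v → E u v))

  InCPlus : VSet → Set
  InCPlus X = Clique X
    ⊎ ∃[ v ] (X v × Clique (λ u → X u × u ≢ v) × AtMost1 (λ u → X u × E v u))

  CoStar : VSet → Set
  CoStar X = ∃[ c ] (X c × (∀ u → X u → ¬ E c u) × Clique (λ u → X u × u ≢ c))

  -- the part of index i of a partition given by a labelling f : V → Fin l
  -- (parts may be empty)
  Part : ∀ {l} → (Fin n → Fin l) → Fin l → VSet
  Part f i v = f v ≡ i

  EPS1 : ℕ → Set
  EPS1 l = ∀ s → 1 ≤ s → s ≤ l →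
    ∃[ f ] ∀ (i : Fin l) → (toℕ i < s → Stable (Part f i))
                         × (s ≤ toℕ i → Clique (Part f i))

  CliquesAnd : ℕ → (VSet → Set) → Set
  CliquesAnd l P = ∃[ f ] ∃[ j ]
    (P (Part {l} f j) × (∀ i → i ≢ j → Clique (Part f i)))

  EPS2 : ℕ → Set
  EPS2 l = CliquesAnd l InUnionS2C × CliquesAnd l InUnionK2C
         × CliquesAnd l InJoinS2C × CliquesAnd l InCPlus

  EPS3 : ℕ → Set
  EPS3 l = ¬ CliquesAnd l (λ X → Clique X ⊎ CoStar X)

  IsEPS : ℕ → Set
  IsEPS l = EPS1 l × EPS2 l × EPS3 l

module Submission where

-- Call a graph with l ≥ 2 extendable if it satisfies (EPS1) and (EPS2) for l,
-- has more than 3l vertices, and carries a proper 3-colouring in which every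
-- triangle dominates the graph. Extendable graphs satisfy (EPS3): in a
-- partition into l − 1 cliques and a clique or co-star, every part is rainbow
-- once the centre of the co-star is recoloured with a colour missing from the
-- rest of it (domination guarantees one), so there are at most 3l vertices.
-- Adding a triangle whose vertex j is joined to the old vertices of colour j
-- turns an extendable graph for l into one for l + 1: the triangle is an extra
-- clique part, and for s = l + 1 the colour classes are the stable sets. A
-- 16-vertex extendable graph for l = 5 starts the induction.

open import Defs
open import Data.Nat using (ℕ; zero; suc; _+_; _*_; _≤_; _<_; z≤n; s≤s; _<?_; _≤?_; _≡ᵇ_)
open import Data.Nat.Base using (s≤s⁻¹)
open import Data.Nat.Properties
  using (≮⇒≥; <⇒≱; ≤-refl; ≤-trans; m≤n⇒m<n∨m≡n; m≤n⇒m≤1+n; m≤n⇒m≤o+n)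
open import Data.Fin using (Fin; toℕ; #_; combine; inject≤; splitAt; join; _↑ʳ_; fromℕ; inject₁)
open import Data.Fin.Patterns using (0F; 1F; 2F; 3F; 4F)
open import Data.Fin.Properties
  using (_≟_; all?; any?; pigeonhole; combine-injective; <⇒≢; ¬∀⟶∃¬; inject≤-injective; toℕ-inject≤;
         toℕ<n; join-splitAt; splitAt⁻¹-↑ʳ; fromℕ≢inject₁; inject₁-injective; toℕ-fromℕ; toℕ-inject₁)
open import Data.Vec using (Vec; []; _∷_; lookup)
open import Data.Vec.Functional using (updateAt)
open import Data.Vec.Functional.Properties using (updateAt-updates; updateAt-minimal)
open import Data.List using (List; []; _∷_)
open import Data.Bool using (Bool; true; false; not)
open import Data.Bool.ListAction using (any)
import Data.Bool.Properties as Bool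
open import Data.Product using (∃-syntax; _×_; _,_; proj₁; proj₂; uncurry)
open import Data.Sum using (_⊎_; inj₁; inj₂; [_,_]′; map; map₁)
open import Data.Sum.Properties using (inj₂-injective)
open import Data.Empty using (⊥-elim)
open import Function using (_∘_; const; id)
open import Function.Bundles using (mk⇔)
open import Relation.Nullary using (¬_; Dec; yes; no; does; contradiction)
open import Relation.Nullary.Decidable
  using (_×-dec_; _⊎-dec_; _→-dec_; ¬?; from-yes; dec-true; dec-false; does-⇔)
open import Relation.Unary using (Decidable)
open import Relation.Binary.PropositionalEquality using (_≡_; _≢_; refl; sym; trans; cong; subst)

Rainbow : ∀ {n k} → (Fin n → Fin k) → (Fin n → Set) → Set
Rainbow g X = ∀ u v → X u → X v → g u ≡ g v → u ≡ v

Rainbow-cong : ∀ {n k} {g h : Fin n → Fin k} {X : Fin n → Set} →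
               (∀ v → X v → g v ≡ h v) → Rainbow g X → Rainbow h X
Rainbow-cong g≗h rainbow u v Xu Xv same =
  rainbow u v Xu Xv (trans (g≗h u Xu) (trans same (sym (g≗h v Xv))))

jointly-injective⇒n≤l*k : ∀ {n l k} (f : Fin n → Fin l) (g : Fin n → Fin k) →
                          (∀ u v → f u ≡ f v → g u ≡ g v → u ≡ v) → n ≤ l * k
jointly-injective⇒n≤l*k f g injective = ≮⇒≥ λ l*k<n →
  let u , v , u<v , same = pigeonhole l*k<n (λ v → combine (f v) (g v))
  in <⇒≢ u<v (uncurry (injective u v) (combine-injective _ _ _ _ same))

does-true : ∀ {A : Set} (a? : Dec A) → does a? ≡ true → A
does-true (yes a) _ = a

fromℕ-or-inject₁ : ∀ {l} (i : Fin (suc l)) → i ≡ fromℕ l ⊎ ∃[ k ] i ≡ inject₁ k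
fromℕ-or-inject₁ {zero} 0F = inj₁ refl
fromℕ-or-inject₁ {suc l} 0F = inj₂ (0F , refl)
fromℕ-or-inject₁ {suc l} (Fin.suc i) with fromℕ-or-inject₁ i
... | inj₁ refl = inj₁ refl
... | inj₂ (k , refl) = inj₂ (Fin.suc k , refl)

pairwise-distinct-cover : ∀ (i j k : Fin 3) → i ≢ j → j ≢ k → i ≢ k → ∀ m → m ≡ i ⊎ m ≡ j ⊎ m ≡ k
pairwise-distinct-cover = from-yes (all? λ (i : Fin 3) → all? λ j → all? λ k →
  ¬? (i ≟ j) →-dec ¬? (j ≟ k) →-dec ¬? (i ≟ k) →-dec all? λ m → m ≟ i ⊎-dec m ≟ j ⊎-dec m ≟ k)

module _ (G : Graph) where
  open Graph G using (n; adj)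

  E? : ∀ u v → Dec (E G u v)
  E? u v = adj u v Bool.≟ true

  part? : ∀ {l} (f : Fin n → Fin l) i → Decidable (Part G f i)
  part? f i v = f v ≟ i

  ProperColouring : ∀ {k} → (Fin n → Fin k) → Set
  ProperColouring col = ∀ u v → col u ≡ col v → ¬ E G u v

  ClosedNbhd : Fin n → Fin n → Set
  ClosedNbhd a c = c ≡ a ⊎ E G c a

  TrianglesDominate : Set
  TrianglesDominate = ∀ a b d → E G a b → E G b d → E G a d →
                      ∀ c → ClosedNbhd a c ⊎ ClosedNbhd b c ⊎ ClosedNbhd d c

  clique⇒rainbow : ∀ {k} {col : Fin n → Fin k} {X} →
                   ProperColouring col → Clique G X → Rainbow col X
  clique⇒rainbow proper clique u v Xu Xv same with u ≟ v
  ... | yes u≡v = u≡v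
  ... | no u≢v = contradiction (clique u v Xu Xv u≢v) (proper u v same)

  -- As c sees no vertex of the clique X ∖ c, domination forbids X ∖ c from
  -- carrying all three colours; c is recoloured with a missing one.
  coStar⇒rainbow : ∀ {col : Fin n → Fin 3} {X} → Decidable X →
                   ProperColouring col → TrianglesDominate → CoStar G X →
                   ∃[ g ] (Rainbow g X × (∀ v → ¬ X v → g v ≡ col v))
  coStar⇒rainbow {col} {X} X? proper dominate (c , Xc , c-isolated , rest-clique) =
    g , rainbow , λ v ¬Xv → g-off (λ v≡c → ¬Xv (subst X (sym v≡c) Xc))
    where
    Rest : Fin n → Set
    Rest v = X v × v ≢ c

    Coloured : Fin 3 → Set
    Coloured i = ∃[ v ] (Rest v × col v ≡ i)

    far : ∀ {a} → Rest a → ¬ ClosedNbhd a c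
    far (_ , a≢c) (inj₁ c≡a) = a≢c (sym c≡a)
    far (Xa , _) (inj₂ ca) = c-isolated _ Xa ca

    distinct : ∀ {a b i j} → col a ≡ i → col b ≡ j → i ≢ j → a ≢ b
    distinct refl refl i≢j refl = i≢j refl

    not-all-coloured : ¬ (∀ i → Coloured i)
    not-all-coloured all-coloured with all-coloured 0F | all-coloured 1F | all-coloured 2F
    ... | a , ra , ca | b , rb , cb | d , rd , cd =
      [ far ra , [ far rb , far rd ]′ ]′
        (dominate a b d (edge ra rb a≢b) (edge rb rd b≢d) (edge ra rd a≢d) c)
      where
      edge : ∀ {u v} → Rest u → Rest v → u ≢ v → E G u v
      edge ru rv = rest-clique _ _ ru rv
      a≢b = distinct ca cb λ ()
      b≢d = distinct cb cd λ ()
      a≢d = distinct ca cd λ ()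

    missing : ∃[ m ] ¬ Coloured m
    missing = ¬∀⟶∃¬ 3 Coloured (λ i → any? λ v → (X? v ×-dec ¬? (v ≟ c)) ×-dec (col v ≟ i))
                    not-all-coloured

    g : Fin n → Fin 3
    g = updateAt col c (const (proj₁ missing))

    g-off : ∀ {v} → v ≢ c → g v ≡ col v
    g-off {v} v≢c = updateAt-minimal v c col v≢c

    uncoloured : ∀ v → Rest v → ¬ g c ≡ g v
    uncoloured v rv same =
      proj₂ missing (v , rv , trans (sym (g-off (proj₂ rv))) (trans (sym same) (updateAt-updates c col)))

    rainbow : Rainbow g X
    rainbow u v Xu Xv same with u ≟ c | v ≟ c
    ... | yes refl | yes refl = refl
    ... | yes refl | no v≢c = ⊥-elim (uncoloured v (Xv , v≢c) same)
    ... | no u≢c | yes refl = ⊥-elim (uncoloured u (Xu , u≢c) (sym same))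
    ... | no u≢c | no v≢c =
      clique⇒rainbow proper rest-clique u v (Xu , u≢c) (Xv , v≢c)
                     (trans (sym (g-off u≢c)) (trans same (g-off v≢c)))

  cliquesAnd-clique⊎coStar⇒n≤l*3 :
    ∀ {l} {col : Fin n → Fin 3} → ProperColouring col → TrianglesDominate →
    CliquesAnd G l (λ X → Clique G X ⊎ CoStar G X) → n ≤ l * 3
  cliquesAnd-clique⊎coStar⇒n≤l*3 {col = col} proper dominate (f , j , special , cliques) =
    jointly-injective⇒n≤l*k f g injective
    where
    recoloured : ∃[ g ] (Rainbow g (Part G f j) × (∀ v → ¬ Part G f j v → g v ≡ col v))
    recoloured = [ (λ clique → col , clique⇒rainbow proper clique , λ _ _ → refl)
                 , coStar⇒rainbow (part? f j) proper dominate ]′ special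

    g : Fin n → Fin 3
    g = proj₁ recoloured

    injective : ∀ u v → f u ≡ f v → g u ≡ g v → u ≡ v
    injective u v fu≡fv with f u ≟ j
    ... | yes fu≡j = proj₁ (proj₂ recoloured) u v fu≡j (trans (sym fu≡fv) fu≡j)
    ... | no fu≢j =
      Rainbow-cong col≗g (clique⇒rainbow proper (cliques (f u) fu≢j)) u v refl (sym fu≡fv)
      where
      col≗g : ∀ w → f w ≡ f u → col w ≡ g w
      col≗g w fw≡fu = sym (proj₂ (proj₂ recoloured) w λ fw≡j → fu≢j (trans (sym fw≡fu) fw≡j))

  StableCliquePartition : ℕ → ℕ → Set
  StableCliquePartition l s =
    ∃[ f ] ∀ (i : Fin l) → (toℕ i < s → Stable G (Part G f i)) × (s ≤ toℕ i → Clique G (Part G f i))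

  colourClasses-partition : ∀ {k l s} {col : Fin n → Fin k} →
                            ProperColouring col → k ≤ s → s ≤ l → StableCliquePartition l s
  colourClasses-partition {k} {col = col} proper k≤s s≤l = f , λ i → stable i , empty i
    where
    k≤l = ≤-trans k≤s s≤l

    f : Fin n → Fin _
    f v = inject≤ (col v) k≤l

    stable : ∀ i → toℕ i < _ → Stable G (Part G f i)
    stable i _ u v fu≡i fv≡i _ = proper u v (inject≤-injective k≤l k≤l _ _ (trans fu≡i (sym fv≡i)))

    empty : ∀ i → _ ≤ toℕ i → Clique G (Part G f i)
    empty i s≤i u _ refl _ _ = contradiction (≤-trans k≤s s≤i) (<⇒≱ f[u]<k)
      where
      f[u]<k : toℕ (f u) < k
      f[u]<k = subst (_< k) (sym (toℕ-inject≤ (col u) k≤l)) (toℕ<n (col u))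

  module _ {X Y : Fin n → Set} (X? : Decidable X) (Y? : Decidable Y) where

    noEdgesBetween? : Dec (∀ u v → X u → Y v → ¬ E G u v)
    noEdgesBetween? = all? λ u → all? λ v → X? u →-dec Y? v →-dec ¬? (E? u v)

    allEdgesBetween? : Dec (∀ u v → X u → Y v → E G u v)
    allEdgesBetween? = all? λ u → all? λ v → X? u →-dec Y? v →-dec E? u v

  module _ {X : Fin n → Set} (X? : Decidable X) where

    clique? : Dec (Clique G X)
    clique? = all? λ u → all? λ v → X? u →-dec X? v →-dec ¬? (u ≟ v) →-dec E? u v

    stable? : Dec (Stable G X)
    stable? = all? λ u → all? λ v → X? u →-dec X? v →-dec ¬? (u ≟ v) →-dec ¬? (E? u v)

    atMost1? : Dec (AtMost1 G X)
    atMost1? = all? λ u → all? λ v → X? u →-dec X? v →-dec u ≟ v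

    atMost2? : Dec (AtMost2 G X)
    atMost2? = all? λ u → all? λ v → all? λ w →
      X? u →-dec X? v →-dec X? w →-dec (u ≟ v ⊎-dec u ≟ w ⊎-dec v ≟ w)

  module _ {X : Fin n → Set} (X? : Decidable X) (side : Fin n → Bool) where
    private
      A B : Fin n → Set
      A = SideA G X side
      B = SideB G X side

    sideA? : Decidable A
    sideA? v = X? v ×-dec side v Bool.≟ true

    sideB? : Decidable B
    sideB? v = X? v ×-dec side v Bool.≟ false

    unionS2C? : Dec (AtMost2 G A × Stable G A × Clique G B × (∀ u v → A u → B v → ¬ E G u v))
    unionS2C? = atMost2? sideA? ×-dec stable? sideA? ×-dec clique? sideB? ×-dec noEdgesBetween? sideA? sideB?

    unionK2C? : Dec (AtMost2 G A × Clique G A × Clique G B × (∀ u v → A u → B v → ¬ E G u v))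
    unionK2C? = atMost2? sideA? ×-dec clique? sideA? ×-dec clique? sideB? ×-dec noEdgesBetween? sideA? sideB?

    joinS2C? : Dec (AtMost2 G A × Stable G A × Clique G B × (∀ u v → A u → B v → E G u v))
    joinS2C? = atMost2? sideA? ×-dec stable? sideA? ×-dec clique? sideB? ×-dec allEdgesBetween? sideA? sideB?

  stableCliquePartition? : ∀ {l} (f : Fin n → Fin l) s →
    Dec (∀ (i : Fin l) → (toℕ i < s → Stable G (Part G f i)) × (s ≤ toℕ i → Clique G (Part G f i)))
  stableCliquePartition? f s =
    all? λ i → (toℕ i <? s →-dec stable? (part? f i)) ×-dec (s ≤? toℕ i →-dec clique? (part? f i))

  otherPartsCliques? : ∀ {l} (f : Fin n → Fin l) j → Dec (∀ i → i ≢ j → Clique G (Part G f i))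
  otherPartsCliques? f j = all? λ i → ¬? (i ≟ j) →-dec clique? (part? f i)

  properColouring? : ∀ {k} (col : Fin n → Fin k) → Dec (ProperColouring col)
  properColouring? col = all? λ u → all? λ v → col u ≟ col v →-dec ¬? (E? u v)

  trianglesDominate? : Dec TrianglesDominate
  trianglesDominate? = all? λ a → all? λ b → all? λ d → E? a b →-dec E? b d →-dec E? a d →-dec
    all? λ c → closedNbhd? a c ⊎-dec closedNbhd? b c ⊎-dec closedNbhd? d c
    where
    closedNbhd? : ∀ a c → Dec (ClosedNbhd a c)
    closedNbhd? a c = c ≟ a ⊎-dec E? c a

module Extension (G : Graph) (col : Fin (Graph.n G) → Fin 3) where
  open Graph G using (n; adj) renaming (sym to adj-sym; irrefl to adj-irrefl)

  Vertex : Set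
  Vertex = Fin 3 ⊎ Fin n

  adjᵛ : Vertex → Vertex → Bool
  adjᵛ (inj₁ i) (inj₁ j) = not (does (i ≟ j))
  adjᵛ (inj₁ j) (inj₂ v) = does (col v ≟ j)
  adjᵛ (inj₂ u) (inj₁ j) = does (col u ≟ j)
  adjᵛ (inj₂ u) (inj₂ v) = adj u v

  Eᵛ : Vertex → Vertex → Set
  Eᵛ a b = adjᵛ a b ≡ true

  adjᵛ-sym : ∀ a b → adjᵛ a b ≡ adjᵛ b a
  adjᵛ-sym (inj₁ i) (inj₁ j) = cong not (does-⇔ (mk⇔ sym sym) (i ≟ j) (j ≟ i))
  adjᵛ-sym (inj₁ j) (inj₂ v) = refl
  adjᵛ-sym (inj₂ u) (inj₁ j) = refl
  adjᵛ-sym (inj₂ u) (inj₂ v) = adj-sym u v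

  adjᵛ-irrefl : ∀ a → adjᵛ a a ≡ false
  adjᵛ-irrefl (inj₁ i) = cong not (dec-true (i ≟ i) refl)
  adjᵛ-irrefl (inj₂ v) = adj-irrefl v

  new-new-edge : ∀ {i j} → Eᵛ (inj₁ i) (inj₁ j) → i ≢ j
  new-new-edge {i} {j} e i≡j with () ← trans (sym e) (cong not (dec-true (i ≟ j) i≡j))

  new-old-edge : ∀ {j v} → Eᵛ (inj₁ j) (inj₂ v) → col v ≡ j
  new-old-edge = does-true (col _ ≟ _)

  split : Fin (3 + n) → Vertex
  split = splitAt 3

  split-injective : ∀ {x y} → split x ≡ split y → x ≡ y
  split-injective {x} {y} eq =
    trans (sym (join-splitAt 3 n x)) (trans (cong (join 3 n) eq) (join-splitAt 3 n y))

  old : Fin n → Fin (3 + n)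
  old = 3 ↑ʳ_

  old-injective : ∀ {u v} → old u ≡ old v → u ≡ v
  old-injective = inj₂-injective ∘ cong split

  extended : Graph
  extended = record
    { n = 3 + n
    ; adj = λ x y → adjᵛ (split x) (split y)
    ; sym = λ x y → adjᵛ-sym (split x) (split y)
    ; irrefl = λ x → adjᵛ-irrefl (split x)
    }

  shift : Fin 3 → Fin 3
  shift 0F = 1F
  shift 1F = 2F
  shift 2F = 0F

  shift-injective : ∀ i j → shift i ≡ shift j → i ≡ j
  shift-injective = from-yes (all? λ i → all? λ j → shift i ≟ shift j →-dec i ≟ j)

  shift-fixedPointFree : ∀ i → shift i ≢ i
  shift-fixedPointFree = from-yes (all? λ i → ¬? (shift i ≟ i))

  colourᵛ : Vertex → Fin 3
  colourᵛ (inj₁ j) = shift j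
  colourᵛ (inj₂ v) = col v

  extendedColouring : Fin (3 + n) → Fin 3
  extendedColouring = colourᵛ ∘ split

  module _ (proper : ProperColouring G col) where

    extended-proper : ProperColouring extended extendedColouring
    extended-proper x y = properᵛ (split x) (split y)
      where
      properᵛ : ∀ a b → colourᵛ a ≡ colourᵛ b → ¬ Eᵛ a b
      properᵛ (inj₁ i) (inj₁ j) same e = new-new-edge e (shift-injective i j same)
      properᵛ (inj₁ j) (inj₂ v) same e = shift-fixedPointFree j (trans same (new-old-edge e))
      properᵛ (inj₂ u) (inj₁ j) same e = shift-fixedPointFree j (trans (sym same) (new-old-edge e))
      properᵛ (inj₂ u) (inj₂ v) same e = proper u v same e

    ClosedNbhdᵛ : Vertex → Vertex → Set
    ClosedNbhdᵛ a c = c ≡ a ⊎ Eᵛ c a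

    no-new-old-old : ∀ {j u v} → Eᵛ (inj₁ j) (inj₂ u) → Eᵛ (inj₁ j) (inj₂ v) → ¬ Eᵛ (inj₂ u) (inj₂ v)
    no-new-old-old ju jv = proper _ _ (trans (new-old-edge ju) (sym (new-old-edge jv)))

    no-new-new-old : ∀ {i j w} → Eᵛ (inj₁ i) (inj₁ j) → Eᵛ (inj₁ i) (inj₂ w) → ¬ Eᵛ (inj₁ j) (inj₂ w)
    no-new-new-old ij iw jw = new-new-edge ij (trans (sym (new-old-edge iw)) (new-old-edge jw))

    -- The triangles of the extension are the old ones and the new one; each
    -- of them has one vertex of every colour, and a new vertex j sees all old
    -- vertices of colour j.
    trianglesDominateᵛ : TrianglesDominate G → ∀ a b d → Eᵛ a b → Eᵛ b d → Eᵛ a d →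
                         ∀ c → ClosedNbhdᵛ a c ⊎ ClosedNbhdᵛ b c ⊎ ClosedNbhdᵛ d c
    trianglesDominateᵛ dominate (inj₂ a) (inj₂ b) (inj₂ d) ab bd ad (inj₂ c) =
      map old-old (map old-old old-old) (dominate a b d ab bd ad c)
      where
      old-old : ∀ {u} → ClosedNbhd G u c → ClosedNbhdᵛ (inj₂ u) (inj₂ c)
      old-old = map₁ (cong inj₂)
    trianglesDominateᵛ dominate (inj₂ a) (inj₂ b) (inj₂ d) ab bd ad (inj₁ m) =
      map new-old (map new-old new-old)
        (pairwise-distinct-cover (col a) (col b) (col d) (differ ab) (differ bd) (differ ad) m)
      where
      differ : ∀ {u v} → E G u v → col u ≢ col v
      differ e same = proper _ _ same e
      new-old : ∀ {u} → m ≡ col u → ClosedNbhdᵛ (inj₂ u) (inj₁ m)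
      new-old m≡col = inj₂ (dec-true (col _ ≟ m) (sym m≡col))
    trianglesDominateᵛ dominate (inj₁ i) (inj₁ j) (inj₁ k) ij jk ik (inj₁ m) =
      map new-new (map new-new new-new)
        (pairwise-distinct-cover i j k (new-new-edge ij) (new-new-edge jk) (new-new-edge ik) m)
      where
      new-new : ∀ {t} → m ≡ t → ClosedNbhdᵛ (inj₁ t) (inj₁ m)
      new-new = inj₁ ∘ cong inj₁
    trianglesDominateᵛ dominate (inj₁ i) (inj₁ j) (inj₁ k) ij jk ik (inj₂ w) =
      map old-new (map old-new old-new)
        (pairwise-distinct-cover i j k (new-new-edge ij) (new-new-edge jk) (new-new-edge ik) (col w))
      where
      old-new : ∀ {t} → col w ≡ t → ClosedNbhdᵛ (inj₁ t) (inj₂ w)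
      old-new = inj₂ ∘ dec-true (col w ≟ _)
    trianglesDominateᵛ _ (inj₁ j) (inj₂ u) (inj₂ v) ju uv jv _ = ⊥-elim (no-new-old-old ju jv uv)
    trianglesDominateᵛ _ (inj₂ u) (inj₁ j) (inj₂ v) uj jv uv _ = ⊥-elim (no-new-old-old uj jv uv)
    trianglesDominateᵛ _ (inj₂ u) (inj₂ v) (inj₁ j) uv vj uj _ = ⊥-elim (no-new-old-old uj vj uv)
    trianglesDominateᵛ _ (inj₁ i) (inj₁ j) (inj₂ w) ij jw iw _ = ⊥-elim (no-new-new-old ij iw jw)
    trianglesDominateᵛ _ (inj₁ i) (inj₂ w) (inj₁ j) iw wj ij _ = ⊥-elim (no-new-new-old ij iw wj)
    trianglesDominateᵛ _ (inj₂ w) (inj₁ i) (inj₁ j) wi ij wj _ = ⊥-elim (no-new-new-old ij wi wj)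

    extended-trianglesDominate : TrianglesDominate G → TrianglesDominate extended
    extended-trianglesDominate dominate x y z xy yz xz w =
      map lift (map lift lift) (trianglesDominateᵛ dominate (split x) (split y) (split z) xy yz xz (split w))
      where
      lift : ∀ {a} → ClosedNbhdᵛ (split a) (split w) → ClosedNbhd extended a w
      lift = map₁ split-injective

  IsImage : (Fin n → Set) → (Fin (3 + n) → Set) → Set
  IsImage X Y = (∀ y → Y y → ∃[ v ] (y ≡ old v × X v)) × (∀ v → X v → Y (old v))

  image-∩ : ∀ {X Y} {P : Fin n → Set} {Q : Fin (3 + n) → Set} →
            (∀ {v} → P v → Q (old v)) → (∀ {v} → Q (old v) → P v) →
            IsImage X Y → IsImage (λ v → X v × P v) (λ y → Y y × Q y)
  image-∩ {P = P} {Q} P⇒Q Q⇒P (Y⊆old[X] , old[X]⊆Y) =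
    preimage , λ v (Xv , Pv) → old[X]⊆Y v Xv , P⇒Q Pv
    where
    preimage : ∀ y → _ × Q y → ∃[ v ] (y ≡ old v × (_ × P v))
    preimage y (Yy , Qy) with Y⊆old[X] y Yy
    ... | v , refl , Xv = v , refl , Xv , Q⇒P Qy

  transfer₂ : ∀ {X Y X′ Y′} {R : Fin n → Fin n → Set} {R′ : Fin (3 + n) → Fin (3 + n) → Set} →
              (∀ {u v} → R u v → R′ (old u) (old v)) → IsImage X X′ → IsImage Y Y′ →
              (∀ u v → X u → Y v → R u v) → ∀ x y → X′ x → Y′ y → R′ x y
  transfer₂ lift (X′⊆old[X] , _) (Y′⊆old[Y] , _) R-holds x y X′x Y′y
    with X′⊆old[X] x X′x | Y′⊆old[Y] y Y′y
  ... | u , refl , Xu | v , refl , Yv = lift (R-holds u v Xu Yv)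

  image-clique : ∀ {X Y} → IsImage X Y → Clique G X → Clique extended Y
  image-clique image = transfer₂ (λ R u≢v → R (u≢v ∘ cong old)) image image

  image-stable : ∀ {X Y} → IsImage X Y → Stable G X → Stable extended Y
  image-stable image = transfer₂ (λ R u≢v → R (u≢v ∘ cong old)) image image

  image-atMost1 : ∀ {X Y} → IsImage X Y → AtMost1 G X → AtMost1 extended Y
  image-atMost1 image = transfer₂ (cong old) image image

  image-atMost2 : ∀ {X Y} → IsImage X Y → AtMost2 G X → AtMost2 extended Y
  image-atMost2 (Y⊆old[X] , _) atMost2 x y z Yx Yy Yz
    with Y⊆old[X] x Yx | Y⊆old[X] y Yy | Y⊆old[X] z Yz
  ... | u , refl , Xu | v , refl , Xv | w , refl , Xw =
    map (cong old) (map (cong old) (cong old)) (atMost2 u v w Xu Xv Xw)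

  extendSide : (Fin n → Bool) → Fin (3 + n) → Bool
  extendSide side = [ const false , side ]′ ∘ split

  image-side : ∀ {X Y} side b → IsImage X Y →
               IsImage (λ v → X v × side v ≡ b) (λ y → Y y × extendSide side y ≡ b)
  image-side side b = image-∩ id id

  image-cPlus : ∀ {X Y} → IsImage X Y → InCPlus G X → InCPlus extended Y
  image-cPlus image (inj₁ clique) = inj₁ (image-clique image clique)
  image-cPlus image (inj₂ (v , Xv , rest-clique , nbhd-atMost1)) =
    inj₂ ( old v , proj₂ image v Xv
         , image-clique (image-∩ (_∘ old-injective) (_∘ cong old) image) rest-clique
         , image-atMost1 (image-∩ id id image) nbhd-atMost1)

  image-unionS2C : ∀ {X Y} → IsImage X Y → InUnionS2C G X → InUnionS2C extended Y
  image-unionS2C image (side , atMost2 , stable , clique , noEdges) =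
    extendSide side , image-atMost2 A atMost2 , image-stable A stable , image-clique B clique ,
    transfer₂ id A B noEdges
    where
    A = image-side side true image
    B = image-side side false image

  image-unionK2C : ∀ {X Y} → IsImage X Y → InUnionK2C G X → InUnionK2C extended Y
  image-unionK2C image (side , atMost2 , clique₁ , clique₂ , noEdges) =
    extendSide side , image-atMost2 A atMost2 , image-clique A clique₁ , image-clique B clique₂ ,
    transfer₂ id A B noEdges
    where
    A = image-side side true image
    B = image-side side false image

  image-joinS2C : ∀ {X Y} → IsImage X Y → InJoinS2C G X → InJoinS2C extended Y
  image-joinS2C image (side , atMost2 , stable , clique , allEdges) =
    extendSide side , image-atMost2 A atMost2 , image-stable A stable , image-clique B clique ,
    transfer₂ id A B allEdges
    where
    A = image-side side true image
    B = image-side side false image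

  partᵛ : ∀ {l} → (Fin n → Fin l) → Vertex → Fin (suc l)
  partᵛ {l} f (inj₁ _) = fromℕ l
  partᵛ f (inj₂ v) = inject₁ (f v)

  -- The new triangle becomes the last part, a clique part for every s ≤ l.
  extendPartition : ∀ {l} → (Fin n → Fin l) → Fin (3 + n) → Fin (suc l)
  extendPartition f = partᵛ f ∘ split

  module _ {l} (f : Fin n → Fin l) where

    image-part : ∀ i → IsImage (Part G f i) (Part extended (extendPartition f) (inject₁ i))
    image-part i = (λ y → preimage y (split y) refl) , λ v → cong inject₁
      where
      preimage : ∀ y a → split y ≡ a → partᵛ f a ≡ inject₁ i → ∃[ v ] (y ≡ old v × f v ≡ i)
      preimage y (inj₁ _) _ e = ⊥-elim (fromℕ≢inject₁ e)
      preimage y (inj₂ v) eq e = v , sym (splitAt⁻¹-↑ʳ eq) , inject₁-injective e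

    newTriangle-clique : Clique extended (Part extended (extendPartition f) (fromℕ l))
    newTriangle-clique x y ex ey x≢y = triangle (split x) (split y) ex ey (x≢y ∘ split-injective)
      where
      triangle : ∀ a b → partᵛ f a ≡ fromℕ l → partᵛ f b ≡ fromℕ l → a ≢ b → Eᵛ a b
      triangle (inj₁ i) (inj₁ j) _ _ a≢b = cong not (dec-false (i ≟ j) (a≢b ∘ cong inj₁))
      triangle (inj₂ _) _ ea _ _ = ⊥-elim (fromℕ≢inject₁ (sym ea))
      triangle (inj₁ _) (inj₂ _) _ eb _ = ⊥-elim (fromℕ≢inject₁ (sym eb))

  extend-cliquesAnd : ∀ {l} {P : (Fin n → Set) → Set} {Q : (Fin (3 + n) → Set) → Set} →
                      (∀ {X Y} → IsImage X Y → P X → Q Y) →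
                      CliquesAnd G l P → CliquesAnd extended (suc l) Q
  extend-cliquesAnd transfer (f , j , Pj , cliques) =
    extendPartition f , inject₁ j , transfer (image-part f j) Pj , others
    where
    others : ∀ i → i ≢ inject₁ j → Clique extended (Part extended (extendPartition f) i)
    others i i≢j with fromℕ-or-inject₁ i
    ... | inj₁ refl = newTriangle-clique f
    ... | inj₂ (k , refl) = image-clique (image-part f k) (cliques k (i≢j ∘ cong inject₁))

  extended-EPS2 : ∀ {l} → EPS2 G l → EPS2 extended (suc l)
  extended-EPS2 (unionS2C , unionK2C , joinS2C , cPlus) =
    extend-cliquesAnd image-unionS2C unionS2C , extend-cliquesAnd image-unionK2C unionK2C ,
    extend-cliquesAnd image-joinS2C joinS2C , extend-cliquesAnd image-cPlus cPlus

  extend-stableCliquePartition : ∀ {l s} → s ≤ l → StableCliquePartition G l s →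
                                 StableCliquePartition extended (suc l) s
  extend-stableCliquePartition {l} {s} s≤l (f , parts) = extendPartition f , part
    where
    part : ∀ i → (toℕ i < s → Stable extended (Part extended (extendPartition f) i))
                × (s ≤ toℕ i → Clique extended (Part extended (extendPartition f) i))
    part i with fromℕ-or-inject₁ i
    ... | inj₁ refl =
      (λ l<s → contradiction s≤l (<⇒≱ (subst (_< s) (toℕ-fromℕ l) l<s))) , λ _ → newTriangle-clique f
    ... | inj₂ (k , refl) =
      (λ k<s → image-stable (image-part f k) (proj₁ (parts k) (subst (_< s) (toℕ-inject₁ k) k<s))) ,
      (λ s≤k → image-clique (image-part f k) (proj₂ (parts k) (subst (s ≤_) (toℕ-inject₁ k) s≤k)))

  extended-EPS1 : ∀ {l} → ProperColouring G col → 2 ≤ l → EPS1 G l → EPS1 extended (suc l)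
  extended-EPS1 proper 2≤l eps1 s 1≤s s≤1+l with m≤n⇒m<n∨m≡n s≤1+l
  ... | inj₁ s<1+l = extend-stableCliquePartition (s≤s⁻¹ s<1+l) (eps1 s 1≤s (s≤s⁻¹ s<1+l))
  ... | inj₂ refl = colourClasses-partition extended (extended-proper proper) (s≤s 2≤l) ≤-refl

member : List ℕ → Fin 16 → Bool
member vs v = any (toℕ v ≡ᵇ_) vs

neighbours : Vec (List ℕ) 16
neighbours = (5 ∷ 7 ∷ 8 ∷ 9 ∷ 14 ∷ 15 ∷ [])
           ∷ (4 ∷ 5 ∷ 6 ∷ 7 ∷ 8 ∷ 9 ∷ 12 ∷ 13 ∷ 14 ∷ 15 ∷ [])
           ∷ (4 ∷ 5 ∷ 6 ∷ 7 ∷ 12 ∷ 13 ∷ [])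
           ∷ (4 ∷ 5 ∷ 6 ∷ 7 ∷ 8 ∷ 9 ∷ 14 ∷ 15 ∷ [])
           ∷ (1 ∷ 2 ∷ 3 ∷ 9 ∷ 14 ∷ 15 ∷ [])
           ∷ (0 ∷ 1 ∷ 2 ∷ 3 ∷ 9 ∷ 14 ∷ 15 ∷ [])
           ∷ (1 ∷ 2 ∷ 3 ∷ 7 ∷ 8 ∷ 9 ∷ 10 ∷ 11 ∷ 14 ∷ 15 ∷ [])
           ∷ (0 ∷ 1 ∷ 2 ∷ 3 ∷ 6 ∷ 12 ∷ 13 ∷ [])
           ∷ (0 ∷ 1 ∷ 3 ∷ 6 ∷ 12 ∷ 13 ∷ [])
           ∷ (0 ∷ 1 ∷ 3 ∷ 4 ∷ 5 ∷ 6 ∷ 10 ∷ 11 ∷ 12 ∷ 13 ∷ [])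
           ∷ (6 ∷ 9 ∷ 12 ∷ 13 ∷ 14 ∷ 15 ∷ [])
           ∷ (6 ∷ 9 ∷ 12 ∷ 13 ∷ 14 ∷ 15 ∷ [])
           ∷ (1 ∷ 2 ∷ 7 ∷ 8 ∷ 9 ∷ 10 ∷ 11 ∷ 14 ∷ 15 ∷ [])
           ∷ (1 ∷ 2 ∷ 7 ∷ 8 ∷ 9 ∷ 10 ∷ 11 ∷ 14 ∷ 15 ∷ [])
           ∷ (0 ∷ 1 ∷ 3 ∷ 4 ∷ 5 ∷ 6 ∷ 10 ∷ 11 ∷ 12 ∷ 13 ∷ [])
           ∷ (0 ∷ 1 ∷ 3 ∷ 4 ∷ 5 ∷ 6 ∷ 10 ∷ 11 ∷ 12 ∷ 13 ∷ [])
           ∷ []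

baseAdj : Fin 16 → Fin 16 → Bool
baseAdj u = member (lookup neighbours u)

base : Graph
base = record
  { n = 16
  ; adj = baseAdj
  ; sym = from-yes (all? λ u → all? λ v → baseAdj u v Bool.≟ baseAdj v u)
  ; irrefl = from-yes (all? λ v → baseAdj v v Bool.≟ false)
  }

baseColouring : Fin 16 → Fin 3
baseColouring = lookup (0F ∷ 0F ∷ 0F ∷ 0F ∷ 1F ∷ 1F ∷ 1F ∷ 2F ∷ 2F ∷ 2F ∷ 0F ∷ 0F ∷ 1F ∷ 1F ∷ 2F ∷ 2F ∷ [])

base-proper : ProperColouring base baseColouring
base-proper = from-yes (properColouring? base baseColouring)

base-trianglesDominate : TrianglesDominate base
base-trianglesDominate = from-yes (trianglesDominate? base)

base-EPS1 : EPS1 base 5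
base-EPS1 1 _ _ = partition , from-yes (stableCliquePartition? base partition 1)
  where
  partition = lookup (1F ∷ 2F ∷ 3F ∷ 4F ∷ 0F ∷ 0F ∷ 4F ∷ 0F ∷ 0F ∷ 1F ∷ 0F ∷ 0F ∷ 2F ∷ 3F ∷ 2F ∷ 4F ∷ [])
base-EPS1 2 _ _ = partition , from-yes (stableCliquePartition? base partition 2)
  where
  partition = lookup (0F ∷ 0F ∷ 0F ∷ 2F ∷ 1F ∷ 1F ∷ 2F ∷ 1F ∷ 1F ∷ 2F ∷ 3F ∷ 4F ∷ 3F ∷ 4F ∷ 3F ∷ 4F ∷ [])
base-EPS1 (suc (suc (suc s))) _ s≤5 =
  colourClasses-partition base base-proper (s≤s (s≤s (s≤s z≤n))) s≤5

base-EPS2 : EPS2 base 5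
base-EPS2 = unionS2C , unionK2C , joinS2C , cPlus
  where
  unionS2C : CliquesAnd base 5 (InUnionS2C base)
  unionS2C = partition , 0F , (side , from-yes (unionS2C? base (part? base partition 0F) side))
           , from-yes (otherPartsCliques? base partition 0F)
    where
    partition = lookup (0F ∷ 1F ∷ 2F ∷ 3F ∷ 0F ∷ 1F ∷ 3F ∷ 2F ∷ 0F ∷ 1F ∷ 0F ∷ 4F ∷ 2F ∷ 4F ∷ 3F ∷ 4F ∷ [])
    side = member (4 ∷ 10 ∷ [])

  unionK2C : CliquesAnd base 5 (InUnionK2C base)
  unionK2C = partition , 0F , (side , from-yes (unionK2C? base (part? base partition 0F) side))
           , from-yes (otherPartsCliques? base partition 0F)
    where
    partition = lookup (0F ∷ 1F ∷ 0F ∷ 2F ∷ 0F ∷ 1F ∷ 2F ∷ 2F ∷ 0F ∷ 1F ∷ 3F ∷ 4F ∷ 3F ∷ 4F ∷ 3F ∷ 4F ∷ [])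
    side = member (0 ∷ 8 ∷ [])

  joinS2C : CliquesAnd base 5 (InJoinS2C base)
  joinS2C = partition , 0F , (side , from-yes (joinS2C? base (part? base partition 0F) side))
          , from-yes (otherPartsCliques? base partition 0F)
    where
    partition = lookup (1F ∷ 2F ∷ 3F ∷ 4F ∷ 4F ∷ 1F ∷ 0F ∷ 3F ∷ 2F ∷ 0F ∷ 0F ∷ 0F ∷ 2F ∷ 3F ∷ 1F ∷ 4F ∷ [])
    side = member (10 ∷ 11 ∷ [])

  cPlus : CliquesAnd base 5 (InCPlus base)
  cPlus = partition , 0F
        , inj₂ ( # 10 , refl
               , from-yes (clique? base λ u → part? base partition 0F u ×-dec ¬? (u ≟ # 10))
               , from-yes (atMost1? base λ u → part? base partition 0F u ×-dec E? base (# 10) u))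
        , from-yes (otherPartsCliques? base partition 0F)
    where
    partition = lookup (0F ∷ 1F ∷ 2F ∷ 3F ∷ 1F ∷ 0F ∷ 3F ∷ 2F ∷ 3F ∷ 0F ∷ 0F ∷ 4F ∷ 2F ∷ 4F ∷ 1F ∷ 4F ∷ [])

record ExtendableEPS : Set where
  field
    graph : Graph
    l : ℕ
    colouring : Fin (Graph.n graph) → Fin 3
    proper : ProperColouring graph colouring
    dominating : TrianglesDominate graph
    eps1 : EPS1 graph l
    eps2 : EPS2 graph l
    2≤l : 2 ≤ l
    l*3<n : l * 3 < Graph.n graph

  isEPS : IsEPS graph l
  isEPS = eps1 , eps2 , λ partition →
    <⇒≱ l*3<n (cliquesAnd-clique⊎coStar⇒n≤l*3 graph proper dominating partition)

extend : ExtendableEPS → ExtendableEPS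
extend S = record
  { graph = extended
  ; l = suc l
  ; colouring = extendedColouring
  ; proper = extended-proper proper
  ; dominating = extended-trianglesDominate proper dominating
  ; eps1 = extended-EPS1 proper 2≤l eps1
  ; eps2 = extended-EPS2 eps2
  ; 2≤l = m≤n⇒m≤1+n 2≤l
  ; l*3<n = s≤s (s≤s (s≤s l*3<n))
  }
  where
  open ExtendableEPS S
  open Extension graph colouring

baseEPS : ExtendableEPS
baseEPS = record
  { graph = base
  ; l = 5
  ; colouring = baseColouring
  ; proper = base-proper
  ; dominating = base-trianglesDominate
  ; eps1 = base-EPS1
  ; eps2 = base-EPS2
  ; 2≤l = s≤s (s≤s z≤n)
  ; l*3<n = ≤-refl
  }

tower : ℕ → ExtendableEPS
tower zero = baseEPS
tower (suc k) = extend (tower k)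

k≤order-tower : ∀ k → k ≤ Graph.n (ExtendableEPS.graph (tower k))
k≤order-tower zero = z≤n
k≤order-tower (suc k) = s≤s (m≤n⇒m≤o+n 2 (k≤order-tower k))

theorem3p12 : ∀ (N : ℕ) → ∃[ H ] (N ≤ Graph.n H × ∃[ l ] (1 ≤ l × IsEPS H l))
theorem3p12 N = graph , k≤order-tower N , l , ≤-trans (s≤s z≤n) 2≤l , isEPS
  where open ExtendableEPS (tower N)
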